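{- For every finite directed acyclic graph $D=(V,E)$ and every threshold function $t:V\to\mathbb{N}$, every execution of the algorithm MTS on input $(D,t)$ returns a minimum-size target set for $D$ with thresholds $t$.
   Context: Digraphs are finite, without loops. For a digraph $G=(V,E)$ and $v\in V$, $\Gamma^{in}(v)=\{u:(u,v)\in E\}$ and $\Gamma^{out}(v)=\{u:(v,u)\in E\}$. Given thresholds $t:V\to\mathbb{N}=\{0,1,2,\dots\}$ and $S\subseteq V$, the activation process starting at $S$ is $A_0=S$ and $A_\ell=A_{\ell-1}\cup\{u\in V: |\Gamma^{in}(u)\cap A_{\ell-1}|\ge t(u)\}$ for $\ell\ge1$. $S$ is a target set for $(G,t)$ if $A_\lambda=V$ for some $\lambda\ge0$. Algorithm MTS on input $(G,t)$: set $S=\emptyset$, $L=\emptyset$, $U=V$, and for each $v\in V$ set $k(v)=t(v)$, $\delta(v)=|\Gamma^{in}(v)|$. While $U\neq\emptyset$, perform one iteration as follows. Case 1: if some $v\in U$ has $k(v)=0$, select such a $v$; for each $u\in\Gamma^{out}(v)\cap U$ set $k(u)=\max(k(u)-1,0)$ and, if $v\notin L$, set $\delta(u)=\delta(u)-1$; then set $U=U\setminus\{v\}$. Case 2: otherwise, if some $v\in U\setminus L$ has $\delta(v)<k(v)$, select such a $v$; set $S=S\cup\{v\}$; for each $u\in\Gamma^{out}(v)\cap U$ set $k(u)=k(u)-1$ and $\delta(u)=\delta(u)-1$; then set $U=U\setminus\{v\}$. Case 3: otherwise, select $v\in U\setminus L$ maximizing $\frac{k(u)}{\delta(u)(\delta(u)+1)}$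 over $u\in U\setminus L$; for each $u\in\Gamma^{out}(v)\cap U$ set $\delta(u)=\delta(u)-1$; set $L=L\cup\{v\}$. When $U=\emptyset$, return $S$. Whenever several nodes qualify in a case, one of them is chosen arbitrarily. -}

module Defs where

open import Data.Nat using (ℕ; zero; suc; _+_; _*_; _∸_; _≤_; _<_; _≤?_)
open import Data.Bool using (Bool; true; false; if_then_else_)
open import Data.Fin using (Fin)
open import Data.Vec using (Vec; lookup; tabulate)
open import Data.Fin.Subset using (Subset; _∈_; _∉_; _∩_; _∪_; _─_; ⁅_⁆; ∣_∣; ⊤; ⊥)
open import Data.Product using (Σ; ∃; _×_; _,_)
open import Relation.Nullary using (¬_)
open import Relation.Nullary.Decidable using (⌊_⌋)
open import Relation.Binary.PropositionalEquality using (_≡_; _≢_)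

record Digraph (n : ℕ) : Set where
  field
    arc      : Fin n → Fin n → Bool
    loopless : ∀ v → arc v v ≡ false

open Digraph public

module _ {n : ℕ} (G : Digraph n) where

  Γin : Fin n → Subset n
  Γin v = tabulate (λ u → arc G u v)

  Γout : Fin n → Subset n
  Γout v = tabulate (λ u → arc G v u)

  data Walk⁺ : Fin n → Fin n → Set where
    edge : ∀ {u w} → arc G u w ≡ true → Walk⁺ u w
    cons : ∀ {u v w} → arc G u v ≡ true → Walk⁺ v w → Walk⁺ u w

  Acyclic : Set
  Acyclic = ∀ v → ¬ Walk⁺ v v

  module _ (t : Fin n → ℕ) where

    activStep : Subset n → Subset n
    activStep A = A ∪ tabulate (λ u → ⌊ t u ≤? ∣ Γin u ∩ A ∣ ⌋)

    activ : Subset n → ℕ → Subset n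
    activ S zero    = S
    activ S (suc ℓ) = activStep (activ S ℓ)

    IsTargetSet : Subset n → Set
    IsTargetSet S = ∃ λ ℓ → activ S ℓ ≡ ⊤

    IsMinTargetSet : Subset n → Set
    IsMinTargetSet S = IsTargetSet S × (∀ S′ → IsTargetSet S′ → ∣ S ∣ ≤ ∣ S′ ∣)

  record MTSState : Set where
    constructor mkState
    field
      S L U : Subset n
      k δ   : Fin n → ℕ

  open MTSState public

  initState : (Fin n → ℕ) → MTSState
  initState t = mkState ⊥ ⊥ ⊤ t (λ v → ∣ Γin v ∣)

  affected : Subset n → Fin n → Fin n → Bool
  affected U v u = lookup (Γout v ∩ U) u

  NoCase1 : MTSState → Set
  NoCase1 st = ∀ w → w ∈ U st → k st w ≢ 0

  NoCase2 : MTSState → Set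
  NoCase2 st = ∀ w → w ∈ U st → w ∉ L st → k st w ≤ δ st w

  data MTSStep : MTSState → MTSState → Set where
    case1 : ∀ {S L U k δ} v → v ∈ U → k v ≡ 0 →
      MTSStep (mkState S L U k δ)
              (mkState S L (U ─ ⁅ v ⁆)
                 (λ u → if affected U v u then k u ∸ 1 else k u)
                 (λ u → if affected U v u
                          then (if lookup L v then δ u else δ u ∸ 1)
                          else δ u))
    case2 : ∀ {S L U k δ} v →
      NoCase1 (mkState S L U k δ) →
      v ∈ U → v ∉ L → δ v < k v →
      MTSStep (mkState S L U k δ)
              (mkState (S ∪ ⁅ v ⁆) L (U ─ ⁅ v ⁆)
                 (λ u → if affected U v u then k u ∸ 1 else k u)
                 (λ u → if affected U v u then δ u ∸ 1 else δ u))
    -- maximizing k(u)/(δ(u)(δ(u)+1)) over U ∖ L, written by cross-multiplication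
    -- (all denominators are positive here since 1 ≤ k ≤ δ on U ∖ L).
    case3 : ∀ {S L U k δ} v →
      NoCase1 (mkState S L U k δ) →
      NoCase2 (mkState S L U k δ) →
      v ∈ U → v ∉ L →
      (∀ u → u ∈ U → u ∉ L → k u * (δ v * suc (δ v)) ≤ k v * (δ u * suc (δ u))) →
      MTSStep (mkState S L U k δ)
              (mkState S (L ∪ ⁅ v ⁆) U k
                 (λ u → if affected U v u then δ u ∸ 1 else δ u))

  data Reachable (t : Fin n → ℕ) : MTSState → Set where
    start : Reachable t (initState t)
    step  : ∀ {s s′} → Reachable t s → MTSStep s s′ → Reachable t s′

-- On an acyclic digraph Case 3 of MTS never applies: every nonempty U contains a source s
-- of D[U] (walking backwards along in-neighbours inside U would otherwise, by pigeonhole,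
-- close a cycle), and δ(s) = 0 < k(s) unless Case 1 applies. Hence L stays empty, δ(v) is
-- the number of in-neighbours of v in U, and k(v) is t(v) minus the number of in-neighbours
-- already removed from U. A node chosen in Case 2 therefore has fewer in-neighbours than
-- its threshold, so it lies in every target set; a node removed in Case 1 is activated one
-- round after all its removed in-neighbours. Once U is empty, S is thus a target set
-- contained in every target set.

module Submission where

open import Defs
open import Data.Bool using (Bool; true; false; _∧_; if_then_else_)
open import Data.Bool.Properties using (T-≡; ∧-identityʳ)
open import Data.Nat using (ℕ; zero; suc; _+_; _∸_; _≤_; _<_; _<′_; ≤′-refl; ≤′-step) renaming (_≟_ to _≟ℕ_)
open import Data.Nat.Properties
  using (+-suc; +-comm; +-assoc; +-cancelˡ-≡; m+n∸m≡n; ∸-+-assoc; m∸n≡0⇒m≤n; m∸n≢0⇒n<m; m≤o∸n⇒m+n≤o;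
         m<n⇒n≢0; n≢0⇒n>0; <⇒≤; <⇒≱; ≤-trans; n<1+n; <⇒<′; module ≤-Reasoning)
open import Data.Fin using (Fin; zero; suc; toℕ; _≟_)
open import Data.Fin.Properties using (any?; pigeonhole)
open import Data.Fin.Subset
  using (Subset; inside; outside; _∈_; _∉_; _⊆_; _∩_; _∪_; _─_; _-_; ⁅_⁆; ∣_∣; ⊤; ⊥; Nonempty; Empty)
open import Data.Fin.Subset.Properties
  using (_∈?_; nonempty?; Empty-unique; ∉⊥; ∈⊤; ∣⊥∣≡0; p⊆q⇒∣p∣≤∣q∣; ∣p∩q∣≤∣p∣; x∈p∩q⁺; x∈p∩q⁻; x∈p∪q⁺; x∈p∪q⁻; p⊆p∪q;
         x∈⁅x⁆; x∈⁅y⁆⇒x≡y; ⊆⊤; ⊆-antisym; ∩-identityʳ; p─⊥≡p; p─⊤≡⊥; p─q⊆p; x∈p∧x≢y⇒x∈p-y)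
open import Data.Vec using ([]; _∷_; lookup; tabulate; here; there)
open import Data.Vec.Properties using (lookup∘tabulate; lookup-zipWith; lookup-replicate; []=⇒lookup; lookup⇒[]=)
open import Data.Product using (∃; _×_; _,_; proj₁; proj₂)
open import Data.Sum using (_⊎_; inj₁; inj₂; [_,_]′)
open import Function using (_∘_; _⇔_; mk⇔; Equivalence)
open import Relation.Nullary using (yes; no; contradiction)
open import Relation.Nullary.Decidable using (toWitness; fromWitness; _×-dec_; ¬?)
open import Relation.Binary.PropositionalEquality
  using (_≡_; _≢_; refl; sym; trans; cong; cong₂; subst; subst₂; module ≡-Reasoning)

open Equivalence using (to; from)

∈-tabulate⇔ : ∀ {n} {f : Fin n → Bool} {x} → x ∈ tabulate f ⇔ f x ≡ true
∈-tabulate⇔ {f = f} {x} = mk⇔ (λ x∈ → trans (sym (lookup∘tabulate f x)) ([]=⇒lookup x∈))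
                              (λ fx → lookup⇒[]= x _ (trans (lookup∘tabulate f x) fx))

x∈p─q⇒x∉q : ∀ {n} {x : Fin n} {p q : Subset n} → x ∈ p ─ q → x ∉ q
x∈p─q⇒x∉q {p = _ ∷ _} {outside ∷ _} here       ()
x∈p─q⇒x∉q {p = _ ∷ _} {_ ∷ _}       (there x∈) (there x∈q) = x∈p─q⇒x∉q x∈ x∈q

x∈p∪⁅y⁆⇒x∈p⊎x≡y : ∀ {n} {x y : Fin n} {p : Subset n} → x ∈ p ∪ ⁅ y ⁆ → x ∈ p ⊎ x ≡ y
x∈p∪⁅y⁆⇒x∈p⊎x≡y {y = y} {p} x∈ with x∈p∪q⁻ p ⁅ y ⁆ x∈
... | inj₁ x∈p   = inj₁ x∈p
... | inj₂ x∈⁅y⁆ = inj₂ (x∈⁅y⁆⇒x≡y y x∈⁅y⁆)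

x∉p-y⇒x≡y⊎x∉p : ∀ {n} {x y : Fin n} {p : Subset n} → x ∉ p - y → x ≡ y ⊎ x ∉ p
x∉p-y⇒x≡y⊎x∉p {x = x} {y} x∉p-y with x ≟ y
... | yes x≡y = inj₁ x≡y
... | no  x≢y = inj₂ (λ x∈p → x∉p-y (x∈p∧x≢y⇒x∈p-y x∈p x≢y))

∣p∣≡∣p∩q∣+∣p─q∣ : ∀ {n} (p q : Subset n) → ∣ p ∣ ≡ ∣ p ∩ q ∣ + ∣ p ─ q ∣
∣p∣≡∣p∩q∣+∣p─q∣ []            []            = refl
∣p∣≡∣p∩q∣+∣p─q∣ (inside  ∷ p) (inside  ∷ q) = cong suc (∣p∣≡∣p∩q∣+∣p─q∣ p q)
∣p∣≡∣p∩q∣+∣p─q∣ (inside  ∷ p) (outside ∷ q) = trans (cong suc (∣p∣≡∣p∩q∣+∣p─q∣ p q)) (sym (+-suc _ _))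
∣p∣≡∣p∩q∣+∣p─q∣ (outside ∷ p) (inside  ∷ q) = ∣p∣≡∣p∩q∣+∣p─q∣ p q
∣p∣≡∣p∩q∣+∣p─q∣ (outside ∷ p) (outside ∷ q) = ∣p∣≡∣p∩q∣+∣p─q∣ p q

x∉p⇒p∩[q-x]≡p∩q : ∀ {n} {x : Fin n} {p q : Subset n} → x ∉ p → p ∩ (q - x) ≡ p ∩ q
x∉p⇒p∩[q-x]≡p∩q {x = zero}  {inside  ∷ p}         x∉p = contradiction here x∉p
x∉p⇒p∩[q-x]≡p∩q {x = zero}  {outside ∷ p} {_ ∷ q} _   = cong (λ r → outside ∷ p ∩ r) (p─⊥≡p q)
x∉p⇒p∩[q-x]≡p∩q {x = suc x} {_ ∷ p}       {_ ∷ q} x∉p = cong (_ ∷_) (x∉p⇒p∩[q-x]≡p∩q (x∉p ∘ there))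

x∈p∩q⇒∣p∩q∣≡1+∣p∩[q-x]∣ : ∀ {n} {x : Fin n} {p q : Subset n} → x ∈ p → x ∈ q → ∣ p ∩ q ∣ ≡ suc ∣ p ∩ (q - x) ∣
x∈p∩q⇒∣p∩q∣≡1+∣p∩[q-x]∣ {p = _ ∷ p} {_ ∷ q} here here = cong (λ r → suc ∣ p ∩ r ∣) (sym (p─⊥≡p q))
x∈p∩q⇒∣p∩q∣≡1+∣p∩[q-x]∣ {p = inside ∷ _} {inside ∷ _} (there x∈p) (there x∈q) =
  cong suc (x∈p∩q⇒∣p∩q∣≡1+∣p∩[q-x]∣ x∈p x∈q)
x∈p∩q⇒∣p∩q∣≡1+∣p∩[q-x]∣ {p = inside ∷ _} {outside ∷ _} (there x∈p) (there x∈q) = x∈p∩q⇒∣p∩q∣≡1+∣p∩[q-x]∣ x∈p x∈q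
x∈p∩q⇒∣p∩q∣≡1+∣p∩[q-x]∣ {p = outside ∷ _} {_ ∷ _}     (there x∈p) (there x∈q) = x∈p∩q⇒∣p∩q∣≡1+∣p∩[q-x]∣ x∈p x∈q

m<n∸o⇒m+o<n : ∀ {m n o} → m < n ∸ o → m + o < n
m<n∸o⇒m+o<n {m} m<n∸o = m≤o∸n⇒m+n≤o (suc m) (<⇒≤ (m∸n≢0⇒n<m (m<n⇒n≢0 m<n∸o))) m<n∸o

∣p∩q∣≡m+∣p∩r∣⇒∣p─r∣≡m+∣p─q∣ : ∀ {n} m (p q r : Subset n) → ∣ p ∩ q ∣ ≡ m + ∣ p ∩ r ∣ → ∣ p ─ r ∣ ≡ m + ∣ p ─ q ∣
∣p∩q∣≡m+∣p∩r∣⇒∣p─r∣≡m+∣p─q∣ m p q r eq = +-cancelˡ-≡ ∣ p ∩ r ∣ _ _ (begin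
  ∣ p ∩ r ∣ + ∣ p ─ r ∣        ≡⟨ ∣p∣≡∣p∩q∣+∣p─q∣ p r ⟨
  ∣ p ∣                        ≡⟨ ∣p∣≡∣p∩q∣+∣p─q∣ p q ⟩
  ∣ p ∩ q ∣ + ∣ p ─ q ∣        ≡⟨ cong (_+ ∣ p ─ q ∣) (trans eq (+-comm m _)) ⟩
  ∣ p ∩ r ∣ + m + ∣ p ─ q ∣    ≡⟨ +-assoc ∣ p ∩ r ∣ m _ ⟩
  ∣ p ∩ r ∣ + (m + ∣ p ─ q ∣)  ∎)
  where open ≡-Reasoning

module _ {n : ℕ} (D : Digraph n) where

  ∈Γin⇔arc : ∀ {u v} → u ∈ Γin D v ⇔ arc D u v ≡ true
  ∈Γin⇔arc = ∈-tabulate⇔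

  arcCount : Fin n → Fin n → ℕ
  arcCount v u = if arc D v u then 1 else 0

  ∣Γin∩U∣≡arcCount+∣Γin∩[U-v]∣ : ∀ {U v} u → v ∈ U → ∣ Γin D u ∩ U ∣ ≡ arcCount v u + ∣ Γin D u ∩ (U - v) ∣
  ∣Γin∩U∣≡arcCount+∣Γin∩[U-v]∣ {v = v} u v∈U with arc D v u in e
  ... | true  = x∈p∩q⇒∣p∩q∣≡1+∣p∩[q-x]∣ (from ∈Γin⇔arc e) v∈U
  ... | false = cong ∣_∣ (sym (x∉p⇒p∩[q-x]≡p∩q v∉Γin))
    where
    v∉Γin : v ∉ Γin D u
    v∉Γin v∈ with () ← trans (sym (to ∈Γin⇔arc v∈)) e

  affected≡arc : ∀ {U v u} → u ∈ U → affected D U v u ≡ arc D v u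
  affected≡arc {U} {v} {u} u∈U = begin
    lookup (Γout D v ∩ U) u           ≡⟨ lookup-zipWith _∧_ u (Γout D v) U ⟩
    lookup (Γout D v) u ∧ lookup U u  ≡⟨ cong₂ _∧_ (lookup∘tabulate (arc D v) u) ([]=⇒lookup u∈U) ⟩
    arc D v u ∧ true                  ≡⟨ ∧-identityʳ _ ⟩
    arc D v u                         ∎
    where open ≡-Reasoning

  affected-∸1≡∸arcCount : ∀ {U v u} x → u ∈ U → (if affected D U v u then x ∸ 1 else x) ≡ x ∸ arcCount v u
  affected-∸1≡∸arcCount {v = v} {u} x u∈U rewrite affected≡arc {v = v} u∈U with arc D v u
  ... | true  = refl
  ... | false = refl

  module _ (t : Fin n → ℕ) where

    activStep⁺ : ∀ {A v} → t v ≤ ∣ Γin D v ∩ A ∣ → v ∈ activStep D t A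
    activStep⁺ t≤ = x∈p∪q⁺ (inj₂ (from ∈-tabulate⇔ (to T-≡ (fromWitness t≤))))

    activStep⁻ : ∀ {A v} → v ∈ activStep D t A → v ∈ A ⊎ t v ≤ ∣ Γin D v ∩ A ∣
    activStep⁻ {A} v∈ with x∈p∪q⁻ A _ v∈
    ... | inj₁ v∈A   = inj₁ v∈A
    ... | inj₂ v∈new = inj₂ (toWitness (from T-≡ (to ∈-tabulate⇔ v∈new)))

    A⊆activStep : ∀ {A} → A ⊆ activStep D t A
    A⊆activStep = x∈p∪q⁺ ∘ inj₁

    activStep-mono : ∀ {A B} → A ⊆ B → activStep D t A ⊆ activStep D t B
    activStep-mono {A} {B} A⊆B v∈ with activStep⁻ v∈
    ... | inj₁ v∈A = A⊆activStep (A⊆B v∈A)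
    ... | inj₂ t≤  = activStep⁺ (≤-trans t≤ (p⊆q⇒∣p∣≤∣q∣ Γin∩A⊆Γin∩B))
      where
      Γin∩A⊆Γin∩B : Γin D _ ∩ A ⊆ Γin D _ ∩ B
      Γin∩A⊆Γin∩B w∈ = let w∈Γ , w∈A = x∈p∩q⁻ _ A w∈ in x∈p∩q⁺ (w∈Γ , A⊆B w∈A)

    S⊆activ : ∀ {S} ℓ → S ⊆ activ D t S ℓ
    S⊆activ zero    = λ v∈ → v∈
    S⊆activ (suc ℓ) = A⊆activStep ∘ S⊆activ ℓ

    activ-monoˡ : ∀ {S S′} → S ⊆ S′ → ∀ ℓ → activ D t S ℓ ⊆ activ D t S′ ℓ
    activ-monoˡ S⊆S′ zero    = S⊆S′
    activ-monoˡ S⊆S′ (suc ℓ) = activStep-mono (activ-monoˡ S⊆S′ ℓ)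

    ∣Γin∣<t⇒∉activ : ∀ {S v} → ∣ Γin D v ∣ < t v → v ∉ S → ∀ ℓ → v ∉ activ D t S ℓ
    ∣Γin∣<t⇒∉activ _      v∉S zero    = v∉S
    ∣Γin∣<t⇒∉activ {v = v} ∣Γin∣<t v∉S (suc ℓ) v∈ with activStep⁻ v∈
    ... | inj₁ v∈A = ∣Γin∣<t⇒∉activ ∣Γin∣<t v∉S ℓ v∈A
    ... | inj₂ t≤  = <⇒≱ ∣Γin∣<t (≤-trans t≤ (∣p∩q∣≤∣p∣ (Γin D v) _))

    ∣Γin∣<t⇒∈TargetSet : ∀ {S v} → ∣ Γin D v ∣ < t v → IsTargetSet D t S → v ∈ S
    ∣Γin∣<t⇒∈TargetSet {S} {v} ∣Γin∣<t (ℓ , activ≡⊤) with v ∈? S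
    ... | yes v∈S = v∈S
    ... | no  v∉S = contradiction (subst (v ∈_) (sym activ≡⊤) ∈⊤) (∣Γin∣<t⇒∉activ ∣Γin∣<t v∉S ℓ)

  Source : Subset n → Fin n → Set
  Source U s = s ∈ U × Empty (Γin D s ∩ U)

  Source⇒∣Γin∩U∣≡0 : ∀ {U s} → Source U s → ∣ Γin D s ∩ U ∣ ≡ 0
  Source⇒∣Γin∩U∣≡0 (_ , no-in-neighbour) = trans (cong ∣_∣ (Empty-unique no-in-neighbour)) (∣⊥∣≡0 n)

  private
    module BackwardChain {U : Subset n} (in-neighbour : ∀ {s} → s ∈ U → ∃ λ u → u ∈ U × arc D u s ≡ true)
                         {v₀ : Fin n} (v₀∈U : v₀ ∈ U) where
      chain∈ : ℕ → ∃ (_∈ U)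
      chain∈ zero    = v₀ , v₀∈U
      chain∈ (suc i) = let u , u∈U , _ = in-neighbour (proj₂ (chain∈ i)) in u , u∈U

      chain : ℕ → Fin n
      chain = proj₁ ∘ chain∈

      back-arc : ∀ i → arc D (chain (suc i)) (chain i) ≡ true
      back-arc i = proj₂ (proj₂ (in-neighbour (proj₂ (chain∈ i))))

      walk : ∀ {i j} → i <′ j → Walk⁺ D (chain j) (chain i)
      walk {i} ≤′-refl          = edge (back-arc i)
      walk (≤′-step {j} i<′j) = cons (back-arc j) (walk i<′j)

      cycle : ∃ λ v → Walk⁺ D v v
      cycle with i , j , i<j , chainᵢ≡chainⱼ ← pigeonhole (n<1+n n) (chain ∘ toℕ)
        = chain (toℕ j) , subst (Walk⁺ D _) chainᵢ≡chainⱼ (walk (<⇒<′ i<j))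

  in-neighbours⇒cycle : ∀ {U} → (∀ {s} → s ∈ U → ∃ λ u → u ∈ U × arc D u s ≡ true) →
                        Nonempty U → ∃ λ v → Walk⁺ D v v
  in-neighbours⇒cycle in-neighbour (_ , v₀∈U) = BackwardChain.cycle in-neighbour v₀∈U

  Acyclic⇒∃Source : Acyclic D → ∀ {U} → Nonempty U → ∃ (Source U)
  Acyclic⇒∃Source acyclic {U} U≠∅ with any? (λ s → (s ∈? U) ×-dec ¬? (nonempty? (Γin D s ∩ U)))
  ... | yes source = source
  ... | no ¬source = contradiction (proj₂ (in-neighbours⇒cycle in-neighbour U≠∅)) (acyclic _)
    where
    in-neighbour : ∀ {s} → s ∈ U → ∃ λ u → u ∈ U × arc D u s ≡ true
    in-neighbour {s} s∈U with nonempty? (Γin D s ∩ U)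
    ... | no  empty      = contradiction (s , s∈U , empty) ¬source
    ... | yes (u , u∈)   = let u∈Γin , u∈U = x∈p∩q⁻ _ U u∈ in u , u∈U , to ∈Γin⇔arc u∈Γin

module _ {n : ℕ} (D : Digraph n) (t : Fin n → ℕ) where

  record Invariant (st : MTSState D) : Set where
    field
      L≡⊥          : L st ≡ ⊥
      δ≡∣Γin∩U∣    : ∀ {v} → v ∈ U st → δ st v ≡ ∣ Γin D v ∩ U st ∣
      k≡t∸∣Γin─U∣  : ∀ {v} → v ∈ U st → k st v ≡ t v ∸ ∣ Γin D v ─ U st ∣
      S-forced     : ∀ {v} → v ∈ S st → ∣ Γin D v ∣ < t v
      rounds       : ℕ
      ∉U⇒activated : ∀ {v} → v ∉ U st → v ∈ activ D t (S st) rounds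

    ∉L : ∀ v → v ∉ L st
    ∉L v = subst (v ∉_) (sym L≡⊥) ∉⊥

  open Invariant

  Invariant-init : Invariant (initState D t)
  Invariant-init = record
    { L≡⊥          = refl
    ; δ≡∣Γin∩U∣    = λ {v} _ → cong ∣_∣ (sym (∩-identityʳ (Γin D v)))
    ; k≡t∸∣Γin─U∣  = λ {v} _ → cong (t v ∸_) (sym (trans (cong ∣_∣ (p─⊤≡⊥ (Γin D v))) (∣⊥∣≡0 n)))
    ; S-forced     = λ v∈⊥ → contradiction v∈⊥ ∉⊥
    ; rounds       = 0
    ; ∉U⇒activated = λ v∉⊤ → contradiction ∈⊤ v∉⊤
    }

  module _ {st : MTSState D} (I : Invariant st) {v : Fin n} (v∈U : v ∈ U st) where

    δ-after-removal : ∀ {u} → u ∈ U st - v →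
                      (if affected D (U st) v u then δ st u ∸ 1 else δ st u) ≡ ∣ Γin D u ∩ (U st - v) ∣
    δ-after-removal {u} u∈U-v = begin
      (if affected D (U st) v u then δ st u ∸ 1 else δ st u)  ≡⟨ affected-∸1≡∸arcCount D (δ st u) u∈U ⟩
      δ st u ∸ c                                              ≡⟨ cong (_∸ c) (δ≡∣Γin∩U∣ I u∈U) ⟩
      ∣ Γin D u ∩ U st ∣ ∸ c                                  ≡⟨ cong (_∸ c) (∣Γin∩U∣≡arcCount+∣Γin∩[U-v]∣ D u v∈U) ⟩
      c + ∣ Γin D u ∩ (U st - v) ∣ ∸ c                        ≡⟨ m+n∸m≡n c _ ⟩
      ∣ Γin D u ∩ (U st - v) ∣                                ∎
      where
      open ≡-Reasoning
      c : ℕ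
      c = arcCount D v u
      u∈U : u ∈ U st
      u∈U = p─q⊆p (U st) ⁅ v ⁆ u∈U-v

    k-after-removal : ∀ {u} → u ∈ U st - v →
                      (if affected D (U st) v u then k st u ∸ 1 else k st u) ≡ t u ∸ ∣ Γin D u ─ (U st - v) ∣
    k-after-removal {u} u∈U-v = begin
      (if affected D (U st) v u then k st u ∸ 1 else k st u)  ≡⟨ affected-∸1≡∸arcCount D (k st u) u∈U ⟩
      k st u ∸ c                                              ≡⟨ cong (_∸ c) (k≡t∸∣Γin─U∣ I u∈U) ⟩
      t u ∸ ∣ Γin D u ─ U st ∣ ∸ c                            ≡⟨ ∸-+-assoc (t u) ∣ Γin D u ─ U st ∣ c ⟩
      t u ∸ (∣ Γin D u ─ U st ∣ + c)                          ≡⟨ cong (t u ∸_) (+-comm ∣ Γin D u ─ U st ∣ c) ⟩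
      t u ∸ (c + ∣ Γin D u ─ U st ∣)                          ≡⟨ cong (t u ∸_) ∣Γin─[U-v]∣≡c+∣Γin─U∣ ⟨
      t u ∸ ∣ Γin D u ─ (U st - v) ∣                          ∎
      where
      open ≡-Reasoning
      c : ℕ
      c = arcCount D v u
      u∈U : u ∈ U st
      u∈U = p─q⊆p (U st) ⁅ v ⁆ u∈U-v
      ∣Γin─[U-v]∣≡c+∣Γin─U∣ : ∣ Γin D u ─ (U st - v) ∣ ≡ c + ∣ Γin D u ─ U st ∣
      ∣Γin─[U-v]∣≡c+∣Γin─U∣ = ∣p∩q∣≡m+∣p∩r∣⇒∣p─r∣≡m+∣p─q∣ c (Γin D u) (U st) (U st - v)
                                (∣Γin∩U∣≡arcCount+∣Γin∩[U-v]∣ D u v∈U)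

    k≡0⇒activated : k st v ≡ 0 → v ∈ activ D t (S st) (suc (rounds I))
    k≡0⇒activated kᵥ≡0 = activStep⁺ D t (begin
      t v                                   ≤⟨ m∸n≡0⇒m≤n (trans (sym (k≡t∸∣Γin─U∣ I v∈U)) kᵥ≡0) ⟩
      ∣ Γin D v ─ U st ∣                    ≤⟨ p⊆q⇒∣p∣≤∣q∣ Γin─U⊆Γin∩activ ⟩
      ∣ Γin D v ∩ activ D t (S st) (rounds I) ∣ ∎)
      where
      open ≤-Reasoning
      Γin─U⊆Γin∩activ : Γin D v ─ U st ⊆ Γin D v ∩ activ D t (S st) (rounds I)
      Γin─U⊆Γin∩activ w∈ = x∈p∩q⁺ (p─q⊆p _ (U st) w∈ , ∉U⇒activated I (x∈p─q⇒x∉q w∈))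

    δ<k⇒∣Γin∣<t : δ st v < k st v → ∣ Γin D v ∣ < t v
    δ<k⇒∣Γin∣<t δᵥ<kᵥ = begin-strict
      ∣ Γin D v ∣                              ≡⟨ ∣p∣≡∣p∩q∣+∣p─q∣ (Γin D v) (U st) ⟩
      ∣ Γin D v ∩ U st ∣ + ∣ Γin D v ─ U st ∣  <⟨ m<n∸o⇒m+o<n ∣Γin∩U∣<t∸∣Γin─U∣ ⟩
      t v                                      ∎
      where
      open ≤-Reasoning
      ∣Γin∩U∣<t∸∣Γin─U∣ : ∣ Γin D v ∩ U st ∣ < t v ∸ ∣ Γin D v ─ U st ∣
      ∣Γin∩U∣<t∸∣Γin─U∣ = subst₂ _<_ (δ≡∣Γin∩U∣ I v∈U) (k≡t∸∣Γin─U∣ I v∈U) δᵥ<kᵥ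

  module _ (acyclic : Acyclic D) where

    source-enables-case2 : ∀ {st} → Invariant st → NoCase1 D st → Nonempty (U st) →
                           ∃ λ s → s ∈ U st × δ st s < k st s
    source-enables-case2 {st} I noCase1 U≠∅ with s , source@(s∈U , _) ← Acyclic⇒∃Source D acyclic U≠∅ =
      s , s∈U , subst (_< k st s) (sym δₛ≡0) (n≢0⇒n>0 (noCase1 s s∈U))
      where
      δₛ≡0 : δ st s ≡ 0
      δₛ≡0 = trans (δ≡∣Γin∩U∣ I s∈U) (Source⇒∣Γin∩U∣≡0 D source)

    Invariant-step : ∀ {st st′} → Invariant st → MTSStep D st st′ → Invariant st′
    Invariant-step {mkState _ L₀ U₀ _ δ₀} I (case1 v v∈U kᵥ≡0) = record
      { L≡⊥          = L≡⊥ I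
      ; δ≡∣Γin∩U∣    = δ-updated
      ; k≡t∸∣Γin─U∣  = k-after-removal I v∈U
      ; S-forced     = S-forced I
      ; rounds       = suc (rounds I)
      ; ∉U⇒activated = [ (λ { refl → k≡0⇒activated I v∈U kᵥ≡0 }) , A⊆activStep D t ∘ ∉U⇒activated I ]′
                       ∘ x∉p-y⇒x≡y⊎x∉p
      }
      where
      v∉L : lookup L₀ v ≡ false
      v∉L = trans (cong (λ L → lookup L v) (L≡⊥ I)) (lookup-replicate v outside)

      δ-updated : ∀ {u} → u ∈ U₀ - v →
                  (if affected D U₀ v u then (if lookup L₀ v then δ₀ u else δ₀ u ∸ 1) else δ₀ u)
                  ≡ ∣ Γin D u ∩ (U₀ - v) ∣
      δ-updated u∈U-v rewrite v∉L = δ-after-removal I v∈U u∈U-v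
    Invariant-step I (case2 v _ v∈U _ δᵥ<kᵥ) = record
      { L≡⊥          = L≡⊥ I
      ; δ≡∣Γin∩U∣    = δ-after-removal I v∈U
      ; k≡t∸∣Γin─U∣  = k-after-removal I v∈U
      ; S-forced     = [ S-forced I , (λ { refl → δ<k⇒∣Γin∣<t I v∈U δᵥ<kᵥ }) ]′ ∘ x∈p∪⁅y⁆⇒x∈p⊎x≡y
      ; rounds       = rounds I
      ; ∉U⇒activated = [ (λ { refl → S⊆activ D t (rounds I) (x∈p∪q⁺ (inj₂ (x∈⁅x⁆ v))) })
                       , activ-monoˡ D t (p⊆p∪q ⁅ v ⁆) (rounds I) ∘ ∉U⇒activated I ]′
                       ∘ x∉p-y⇒x≡y⊎x∉p
      }
    Invariant-step I (case3 v noCase1 noCase2 v∈U _ _) =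
      let s , s∈U , δₛ<kₛ = source-enables-case2 I noCase1 (v , v∈U) in
      contradiction (noCase2 s s∈U (∉L I s)) (<⇒≱ δₛ<kₛ)

    Invariant-reachable : ∀ {st} → Reachable D t st → Invariant st
    Invariant-reachable start          = Invariant-init
    Invariant-reachable (step r st→st′) = Invariant-step (Invariant-reachable r) st→st′

    progress : ∀ {st} → Invariant st → U st ≢ ⊥ → ∃ (MTSStep D st)
    progress {mkState S₀ L₀ U₀ k₀ δ₀} I U≢⊥ with any? (λ w → (w ∈? U₀) ×-dec (k₀ w ≟ℕ 0))
    ... | yes (w , w∈U , k≡0) = _ , case1 w w∈U k≡0
    ... | no ¬case1 =
      let noCase1 : NoCase1 D (mkState S₀ L₀ U₀ k₀ δ₀)
          noCase1 w w∈U k≡0 = ¬case1 (w , w∈U , k≡0)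
          s , s∈U , δₛ<kₛ = source-enables-case2 I noCase1 U≠∅
      in _ , case2 s noCase1 s∈U (∉L I s) δₛ<kₛ
      where
      U≠∅ : Nonempty U₀
      U≠∅ with nonempty? U₀
      ... | yes ne    = ne
      ... | no  empty = contradiction (Empty-unique empty) U≢⊥

theorem6 : ∀ {n} (D : Digraph n) → Acyclic D → (t : Fin n → ℕ) →
    ∀ st → Reachable D t st →
      (U st ≡ ⊥ → IsMinTargetSet D t (S st)) ×
      (U st ≢ ⊥ → ∃ λ st′ → MTSStep D st st′)
theorem6 D acyclic t st reachable = minimum , progress D t acyclic I
  where
  I : Invariant D t st
  I = Invariant-reachable D t acyclic reachable
  open Invariant I

  minimum : U st ≡ ⊥ → IsMinTargetSet D t (S st)
  minimum U≡⊥ = (rounds , ⊆-antisym ⊆⊤ (λ {v} _ → ∉U⇒activated (λ v∈U → ∉⊥ (subst (v ∈_) U≡⊥ v∈U))))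
              , λ S′ S′-target → p⊆q⇒∣p∣≤∣q∣ (λ v∈S → ∣Γin∣<t⇒∈TargetSet D t (S-forced v∈S) S′-target)
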